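{- Let $R$ be a binary relation on a set $X$ and let $R^C=(X\times X)\setminus R$ be its complement. (1) If $R$ is transitive, then $R^C$ satisfies semi-order property 2. (2) If $R$ is symmetric and satisfies semi-order property 2, then $R^C$ is transitive.
   Context: Write $xRy$ for $(x,y)\in R$. Transitive: $xRy\land yRz\to xRz$; symmetric: $xRy\to yRx$; semi-order property 2: for all $w,x,y,z$, $xRy\land yRz\to wRx\lor xRw\lor wRy\lor yRw\lor wRz\lor zRw$. -}

module Defs where

open import Level using (Level; _⊔_)
open import Data.Sum using (_⊎_)
open import Data.Product using (_×_)
open import Relation.Nullary using (¬_)
open import Relation.Binary.Core using (Rel)

Complement : ∀ {a ℓ} {X : Set a} → Rel X ℓ → Rel X ℓ
Complement R x y = ¬ R x y

SemiOrder2 : ∀ {a ℓ} {X : Set a} → Rel X ℓ → Set (a ⊔ ℓ)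
SemiOrder2 R = ∀ w x y z → R x y → R y z →
  R w x ⊎ R x w ⊎ R w y ⊎ R y w ⊎ R w z ⊎ R z w

{-# OPTIONS --safe #-}
module Submission where

open import Defs
open import Data.Product using (_×_; _,_)
open import Data.Sum using (inj₁; inj₂)
open import Relation.Nullary using (yes; no)
open import Relation.Binary.Core using (Rel)
open import Relation.Binary.Definitions using (Transitive; Symmetric)
open import Axiom.ExcludedMiddle using (ExcludedMiddle)

-- If x R w then transitivity forbids w R y (else x R y), so one of x R^C w, w R^C y always holds.
transitive⇒complement-semiOrder2 : ∀ {a ℓ} → ExcludedMiddle ℓ → {X : Set a} (R : Rel X ℓ) →
  Transitive R → SemiOrder2 (Complement R)
transitive⇒complement-semiOrder2 em R trans w x y z ¬xRy _ with em {R x w}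
... | yes xRw = inj₂ (inj₂ (inj₁ λ wRy → ¬xRy (trans xRw wRy)))
... | no ¬xRw = inj₂ (inj₁ ¬xRw)

-- Apply semi-order property 2 to the chain x R z R x with w = y: by symmetry every
-- alternative gives x R y or y R z.
symmetric-semiOrder2⇒complement-transitive : ∀ {a ℓ} {X : Set a} (R : Rel X ℓ) →
  Symmetric R → SemiOrder2 R → Transitive (Complement R)
symmetric-semiOrder2⇒complement-transitive R sym so {x} {y} {z} ¬xRy ¬yRz xRz
  with so y x z x xRz (sym xRz)
... | inj₁ yRx                               = ¬xRy (sym yRx)
... | inj₂ (inj₁ xRy)                        = ¬xRy xRy
... | inj₂ (inj₂ (inj₁ yRz))                 = ¬yRz yRz
... | inj₂ (inj₂ (inj₂ (inj₁ zRy)))          = ¬yRz (sym zRy)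
... | inj₂ (inj₂ (inj₂ (inj₂ (inj₁ yRx))))   = ¬xRy (sym yRx)
... | inj₂ (inj₂ (inj₂ (inj₂ (inj₂ xRy))))   = ¬xRy xRy

mainTheorem6 : ∀ {a ℓ} → ExcludedMiddle ℓ → {X : Set a} (R : Rel X ℓ) →
    (Transitive R → SemiOrder2 (Complement R)) ×
    (Symmetric R → SemiOrder2 R → Transitive (Complement R))
mainTheorem6 em R =
  transitive⇒complement-semiOrder2 em R , symmetric-semiOrder2⇒complement-transitive R
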